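{- Let $G$ be a finite group of order $n$. Then the equivalence class $\mathcal U_1$ is a subgroup of the direct power $G^n$, and every equivalence class is a left coset of $\mathcal U_1$ in $G^n$.
   Context: Identify $G$ with $\mathcal I_n=\{1,\dots,n\}$; tuples are elements of $G^n$ and the group operation $*$ acts entrywise (the group operation of $G^n$). A permutation is a tuple with pairwise distinct entries; $\mathcal W$ is the set of permutations and $\mathbb W=(1,\dots,n)$. For $d\ge0$, a $U$-diagonal of type $V$ in $G[d]$ is a sequence $(W_1,\dots,W_d)\in\mathcal W^d$ with $U*W_1*\cdots*W_d=V$. Tuples $U,V$ are equivalent if for some $d\ge0$ there is a $U$-diagonal of type $V$ in $G[d]$; the classes are the equivalence classes, and $\mathcal U_1$ is the class containing $\mathbb W$. -}

module Defs where

open import Level using (Level; _⊔_)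
open import Data.Nat using (ℕ)
open import Data.Fin using (Fin)
open import Data.Vec using (Vec; foldl)
open import Data.Product using (Σ; ∃; ∃-syntax; _×_; _,_; proj₁)
open import Relation.Binary.PropositionalEquality using (_≡_)
open import Algebra.Bundles using (Group)

record FiniteGroup (c ℓ : Level) (n : ℕ) : Set (Level.suc (c ⊔ ℓ)) where
  field
    group : Group c ℓ
  open Group group public
  field
    enum     : Fin n → Carrier
    enum-inj : ∀ i j → enum i ≈ enum j → i ≡ j
    enum-sur : ∀ g → ∃[ i ] (g ≈ enum i)

module _ {c ℓ : Level} {n : ℕ} (G : FiniteGroup c ℓ n) where
  open FiniteGroup G

  Tuple : Set c
  Tuple = Fin n → Carrier

  _⊛_ : Tuple → Tuple → Tuple
  (U ⊛ V) i = U i ∙ V i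

  εᵗ : Tuple
  εᵗ i = ε

  _⁻¹ᵗ : Tuple → Tuple
  (U ⁻¹ᵗ) i = U i ⁻¹

  _≈ᵗ_ : Tuple → Tuple → Set ℓ
  U ≈ᵗ V = ∀ i → U i ≈ V i

  IsPermutation : Tuple → Set ℓ
  IsPermutation W = ∀ i j → W i ≈ W j → i ≡ j

  Permutation : Set (c ⊔ ℓ)
  Permutation = Σ Tuple IsPermutation

  𝕎 : Tuple
  𝕎 = enum

  diagProduct : ∀ {d} → Tuple → Vec Permutation d → Tuple
  diagProduct U Ws = foldl _ (λ acc W → acc ⊛ proj₁ W) U Ws

  Diagonal : Tuple → Tuple → (d : ℕ) → Set (c ⊔ ℓ)
  Diagonal U V d = Σ (Vec Permutation d) λ Ws → diagProduct U Ws ≈ᵗ V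

  Equivalent : Tuple → Tuple → Set (c ⊔ ℓ)
  Equivalent U V = ∃[ d ] Diagonal U V d

  ClassOf : Tuple → Tuple → Set (c ⊔ ℓ)
  ClassOf U V = Equivalent U V

  𝒰₁ : Tuple → Set (c ⊔ ℓ)
  𝒰₁ = ClassOf 𝕎

  IsSubgroup : ∀ {p} → (Tuple → Set p) → Set (c ⊔ ℓ ⊔ p)
  IsSubgroup P =
    (∀ {U V} → U ≈ᵗ V → P U → P V) ×
    P εᵗ ×
    (∀ {U V} → P U → P V → P (U ⊛ V)) ×
    (∀ {U} → P U → P (U ⁻¹ᵗ))

  LeftCoset : ∀ {p} → Tuple → (Tuple → Set p) → Tuple → Set (c ⊔ ℓ ⊔ p)
  LeftCoset A H V = ∃[ X ] (H X × V ≈ᵗ (A ⊛ X))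

-- Equivalence of tuples is the relation "V ≈ U ∗ P for a product P of permutations"
-- of the direct power Gⁿ. It is symmetric because the entrywise inverse of a
-- permutation is again a permutation, and it is invariant under left
-- multiplication. Hence the class of the identity, which contains the permutation 𝕎
-- and so equals 𝒰₁, is a subgroup, and the class of U is the left coset U ∗ 𝒰₁.
module Submission where

open import Defs
open import Level using (Level)
open import Data.Nat using (ℕ)
open import Data.Fin using (Fin)
open import Data.Product using (_×_; ∃-syntax; _,_; proj₁)
open import Data.Vec using (Vec; []; _∷_; _++_; _∷ʳ_)
open import Function.Bundles using (_⇔_; mk⇔)
open import Relation.Binary.Bundles using (Preorder)
open import Relation.Binary.PropositionalEquality as ≡ using (_≡_)
open import Algebra.Bundles using (Group)
import Algebra.Construct.Pointwise as Pointwise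
import Algebra.Properties.Group as GroupProperties
import Relation.Binary.Reasoning.Setoid as SetoidReasoning
import Relation.Binary.Reasoning.Preorder as PreorderReasoning

module _ {c ℓ : Level} {n : ℕ} (G : FiniteGroup c ℓ n) where

  directPower : Group c ℓ
  directPower = Pointwise.group (Fin n) (FiniteGroup.group G)

  open Group directPower
  open GroupProperties directPower using (//-rightDividesʳ; \\-leftDividesˡ)

  _⁻¹ᵖ : Permutation G → Permutation G
  (W , W-inj) ⁻¹ᵖ = W ⁻¹ , λ i j eq →
    W-inj i j (GroupProperties.⁻¹-injective (FiniteGroup.group G) eq)

  𝕎ᵖ : Permutation G
  𝕎ᵖ = 𝕎 G , FiniteGroup.enum-inj G

  diagProduct-congˡ : ∀ {d} (Ws : Vec (Permutation G) d) {U V} →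
                      U ≈ V → diagProduct G U Ws ≈ diagProduct G V Ws
  diagProduct-congˡ []       U≈V = U≈V
  diagProduct-congˡ (W ∷ Ws) U≈V = diagProduct-congˡ Ws (∙-congʳ U≈V)

  diagProduct-assoc : ∀ {d} A B (Ws : Vec (Permutation G) d) →
                      diagProduct G (A ∙ B) Ws ≈ A ∙ diagProduct G B Ws
  diagProduct-assoc A B []       = refl
  diagProduct-assoc A B (W ∷ Ws) =
    trans (diagProduct-congˡ Ws (assoc A B (proj₁ W)))
          (diagProduct-assoc A (B ∙ proj₁ W) Ws)

  diagProduct-++ : ∀ {d k} U (Ws : Vec (Permutation G) d) (Vs : Vec (Permutation G) k) →
                   diagProduct G U (Ws ++ Vs) ≡ diagProduct G (diagProduct G U Ws) Vs
  diagProduct-++ U []       Vs = ≡.refl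
  diagProduct-++ U (W ∷ Ws) Vs = diagProduct-++ (U ∙ proj₁ W) Ws Vs

  diagProduct-∷ʳ : ∀ {d} U (Ws : Vec (Permutation G) d) W →
                   diagProduct G U (Ws ∷ʳ W) ≡ diagProduct G U Ws ∙ proj₁ W
  diagProduct-∷ʳ U []       W = ≡.refl
  diagProduct-∷ʳ U (V ∷ Ws) W = diagProduct-∷ʳ (U ∙ proj₁ V) Ws W

  reverseInverse : ∀ {d} → Vec (Permutation G) d → Vec (Permutation G) d
  reverseInverse []       = []
  reverseInverse (W ∷ Ws) = reverseInverse Ws ∷ʳ W ⁻¹ᵖ

  diagProduct-reverseInverse : ∀ {d} U (Ws : Vec (Permutation G) d) →
    diagProduct G (diagProduct G U Ws) (reverseInverse Ws) ≈ U
  diagProduct-reverseInverse U []       = refl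
  diagProduct-reverseInverse U (W ∷ Ws) = begin
    diagProduct G (diagProduct G U′ Ws) (reverseInverse Ws ∷ʳ W ⁻¹ᵖ)
      ≡⟨ diagProduct-∷ʳ (diagProduct G U′ Ws) (reverseInverse Ws) (W ⁻¹ᵖ) ⟩
    diagProduct G (diagProduct G U′ Ws) (reverseInverse Ws) ∙ proj₁ W ⁻¹
      ≈⟨ ∙-congʳ (diagProduct-reverseInverse U′ Ws) ⟩
    (U ∙ proj₁ W) ∙ proj₁ W ⁻¹
      ≈⟨ //-rightDividesʳ (proj₁ W) U ⟩
    U ∎
    where
    open SetoidReasoning setoid
    U′ = U ∙ proj₁ W

  infix 4 _∼_
  _∼_ : Tuple G → Tuple G → Set _
  U ∼ V = Equivalent G U V

  ≈⇒∼ : ∀ {U V} → U ≈ V → U ∼ V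
  ≈⇒∼ U≈V = 0 , [] , U≈V

  ∼-trans : ∀ {U V X} → U ∼ V → V ∼ X → U ∼ X
  ∼-trans {U} {V} {X} (_ , Ws , UWs≈V) (_ , Vs , VVs≈X) = _ , Ws ++ Vs , (begin
    diagProduct G U (Ws ++ Vs)           ≡⟨ diagProduct-++ U Ws Vs ⟩
    diagProduct G (diagProduct G U Ws) Vs ≈⟨ diagProduct-congˡ Vs UWs≈V ⟩
    diagProduct G V Vs                    ≈⟨ VVs≈X ⟩
    X                                     ∎)
    where open SetoidReasoning setoid

  ∼-sym : ∀ {U V} → U ∼ V → V ∼ U
  ∼-sym {U} (d , Ws , UWs≈V) = d , reverseInverse Ws ,
    trans (diagProduct-congˡ (reverseInverse Ws) (sym UWs≈V))
          (diagProduct-reverseInverse U Ws)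

  ∼-preorder : Preorder _ _ _
  ∼-preorder = record
    { _≈_        = _≈_
    ; _≲_        = _∼_
    ; isPreorder = record
      { isEquivalence = isEquivalence
      ; reflexive     = ≈⇒∼
      ; trans         = ∼-trans
      }
    }

  ∼-step : ∀ (W : Permutation G) U → U ∼ U ∙ proj₁ W
  ∼-step W U = 1 , W ∷ [] , refl

  ∼-congˡ : ∀ A {U V} → U ∼ V → A ∙ U ∼ A ∙ V
  ∼-congˡ A {U} (d , Ws , UWs≈V) = d , Ws , trans (diagProduct-assoc A U Ws) (∙-congˡ UWs≈V)

  ε∼⇒∼∙ : ∀ {V} U → ε ∼ V → U ∼ U ∙ V
  ε∼⇒∼∙ {V} U ε∼V = begin
    U     ≈⟨ sym (identityʳ U) ⟩
    U ∙ ε ≲⟨ ∼-congˡ U ε∼V ⟩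
    U ∙ V ∎
    where open PreorderReasoning ∼-preorder

  ε∼𝕎 : ε ∼ 𝕎 G
  ε∼𝕎 = ∼-trans (∼-step 𝕎ᵖ ε) (≈⇒∼ (identityˡ (𝕎 G)))

  𝒰₁-isSubgroup : IsSubgroup G (𝒰₁ G)
  𝒰₁-isSubgroup =
      (λ U≈V 𝕎∼U → ∼-trans 𝕎∼U (≈⇒∼ U≈V))
    , ∼-sym ε∼𝕎
    , (λ {U} 𝕎∼U 𝕎∼V → ∼-trans 𝕎∼U (ε∼⇒∼∙ U (∼-trans ε∼𝕎 𝕎∼V)))
    , λ {U} 𝕎∼U → ∼-trans (∼-sym ε∼𝕎) (∼-sym (begin
        U ⁻¹     ≲⟨ ε∼⇒∼∙ (U ⁻¹) (∼-trans ε∼𝕎 𝕎∼U) ⟩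
        U ⁻¹ ∙ U ≈⟨ inverseˡ U ⟩
        ε        ∎))
    where open PreorderReasoning ∼-preorder

  classOf⇔leftCoset : ∀ U V → ClassOf G U V ⇔ LeftCoset G U (𝒰₁ G) V
  classOf⇔leftCoset U V = mk⇔ toCoset fromCoset
    where
    open PreorderReasoning ∼-preorder

    toCoset : U ∼ V → LeftCoset G U (𝒰₁ G) V
    toCoset U∼V = U ⁻¹ ∙ V , 𝕎∼U⁻¹∙V , sym (\\-leftDividesˡ U V)
      where
      𝕎∼U⁻¹∙V : 𝒰₁ G (U ⁻¹ ∙ V)
      𝕎∼U⁻¹∙V = begin
        𝕎 G      ≲⟨ ∼-sym ε∼𝕎 ⟩
        ε        ≈⟨ sym (inverseˡ U) ⟩
        U ⁻¹ ∙ U ≲⟨ ∼-congˡ (U ⁻¹) U∼V ⟩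
        U ⁻¹ ∙ V ∎

    fromCoset : LeftCoset G U (𝒰₁ G) V → U ∼ V
    fromCoset (X , 𝕎∼X , V≈U∙X) = begin
      U     ≲⟨ ε∼⇒∼∙ U (∼-trans ε∼𝕎 𝕎∼X) ⟩
      U ∙ X ≈⟨ sym V≈U∙X ⟩
      V     ∎

lemma4 : ∀ {c ℓ : Level} {n : ℕ} (G : FiniteGroup c ℓ n) →
    IsSubgroup G (𝒰₁ G) ×
    (∀ U → ∃[ A ] (∀ V → ClassOf G U V ⇔ LeftCoset G A (𝒰₁ G) V))
lemma4 G = 𝒰₁-isSubgroup G , λ U → U , classOf⇔leftCoset G U
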